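{- Let $a<b$ be coprime positive integers. Let $k\ge 0$, write $\xi_k=.s_1s_2\ldots s_\ell$ (with $s_i=0$ for $i>\ell$) and $\xi_{k+1}=.s_1's_2'\ldots$. Let $j$ be the smallest index $i\in\{1,\dots,\ell\}$ with $s_i<a$, or $j=\ell+1$ if no such index exists. If $j=1$, then $s_1'=s_1+b$ and $s_i'=s_i$ for all $i>1$. If $j>1$, then $s_{j-1}'=s_{j-1}-a$, $s_j'=s_j+b$, and $s_i'=s_i$ for all other $i$.
   Context: Settlements for the $a$-$b$ chip-firing game: configurations of chips on vertices $1,2,3,\dots$ of $\mathbb{Z}$, written $.s_1s_2\ldots s_\ell$ where $s_i$ is the number of chips at vertex $i$. Let $\xi_0$ be the empty configuration. Given $\xi_k$, obtain $\xi_{k+1}$ by adding $b$ chips to vertex $1$ (modelling one firing of vertex $0$) and then repeatedly firing any vertex $i\ge 1$ that has at least $a+b$ chips: it loses $a+b$ chips, vertex $i+1$ gains $b$ chips, vertex $i-1$ gains $a$ chips if $i-1\ge1$, and the $a$ chips sent to vertex $0$ are discarded; continue until no vertex $i\ge 1$ has at least $a+b$ chips. -}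

module Defs where

open import Data.Nat using (ℕ; zero; suc; _+_; _∸_; _≤_; _<_)
open import Data.Nat.Properties using (_≟_)
open import Data.Product using (_×_)
open import Data.Sum using (_⊎_)
open import Relation.Nullary using (yes; no)
open import Relation.Binary.PropositionalEquality using (_≡_)

-- A chip configuration: vertex i ↦ number of chips at vertex i.
-- Only vertices i ≥ 1 are meaningful; vertex 0 is never given chips
-- (chips sent to vertex 0 are discarded), so it stays 0.
Config : Set
Config = ℕ → ℕ

empty : Config
empty _ = 0

addAt : ℕ → ℕ → Config → Config
addAt i m c n with n ≟ i
... | yes _ = c n + m
... | no  _ = c n

subAt : ℕ → ℕ → Config → Config
subAt i m c n with n ≟ i
... | yes _ = c n ∸ m
... | no  _ = c n

-- firing vertex i ≥ 1 in the a-b chip-firing game: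
-- vertex i loses a+b, vertex i+1 gains b, vertex i-1 gains a if i-1 ≥ 1
-- (the a chips sent to vertex 0 are discarded).
fire : ℕ → ℕ → ℕ → Config → Config
fire a b zero c = c
fire a b (suc zero) c = addAt 2 b (subAt 1 (a + b) c)
fire a b (suc (suc p)) c =
  addAt (suc (suc (suc p))) b (addAt (suc p) a (subAt (suc (suc p)) (a + b) c))

data Fires (a b : ℕ) : Config → Config → Set where
  done : ∀ {c} → Fires a b c c
  step : ∀ {c c'} i → 1 ≤ i → a + b ≤ c i → Fires a b (fire a b i c) c' → Fires a b c c'

Stable : ℕ → ℕ → Config → Set
Stable a b c = ∀ i → 1 ≤ i → c i < a + b

data Settlement (a b : ℕ) : ℕ → Config → Set where
  start : Settlement a b 0 empty
  next  : ∀ {k c c'} → Settlement a b k c → Fires a b (addAt 1 b c) c' →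
          Stable a b c' → Settlement a b (suc k) c'

IsJ : ℕ → Config → ℕ → ℕ → Set
IsJ a s ℓ j =
  (1 ≤ j × j ≤ ℓ × s j < a × (∀ i → 1 ≤ i → i < j → a ≤ s i))
  ⊎ (j ≡ suc ℓ × (∀ i → 1 ≤ i → i ≤ ℓ → a ≤ s i))

module Submission where

-- Let s be a stable configuration. After b chips are dropped on vertex 1,
-- the only vertex that can reach a + b chips is the one that just received
-- b chips, and it does so exactly when it held at least a chips before.
-- Firing it returns the a chips its left neighbour lost when that neighbour
-- fired, so the stabilisation is forced: vertices 1, 2, …, j - 1 fire once
-- each, in order, where j is the first vertex of s with fewer than a chips.

open import Defs
open import Data.Nat using (ℕ; zero; suc; _+_; _∸_; _≤_; _<_; z≤n; s≤s; _≤?_)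
open import Data.Nat.Coprimality using (Coprime)
open import Data.Nat.Properties
open import Data.Product using (_×_; ∃; _,_; proj₁)
open import Data.Sum using (inj₁; inj₂)
open import Data.Empty using (⊥-elim)
open import Relation.Nullary using (Dec; yes; no)
open import Relation.Binary.PropositionalEquality using (_≡_; _≢_; refl; sym; trans; cong; cong₂; subst; _≗_; _→-setoid_; module ≡-Reasoning)
open import Relation.Binary.Definitions using (tri<; tri≈; tri>)
import Relation.Binary.Reasoning.Setoid as SetoidReasoning

addAt-same : ∀ i m c → addAt i m c i ≡ c i + m
addAt-same i m c with i ≟ i
... | yes _  = refl
... | no i≢i = ⊥-elim (i≢i refl)

addAt-other : ∀ i m c {n} → n ≢ i → addAt i m c n ≡ c n
addAt-other i m c {n} n≢i with n ≟ i
... | yes n≡i = ⊥-elim (n≢i n≡i)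
... | no _    = refl

subAt-same : ∀ i m c → subAt i m c i ≡ c i ∸ m
subAt-same i m c with i ≟ i
... | yes _  = refl
... | no i≢i = ⊥-elim (i≢i refl)

subAt-other : ∀ i m c {n} → n ≢ i → subAt i m c n ≡ c n
subAt-other i m c {n} n≢i with n ≟ i
... | yes n≡i = ⊥-elim (n≢i n≡i)
... | no _    = refl

addAt-cong : ∀ i m {c d} → c ≗ d → addAt i m c ≗ addAt i m d
addAt-cong i m c≗d n with n ≟ i
... | yes _ = cong (_+ m) (c≗d n)
... | no _  = c≗d n

subAt-cong : ∀ i m {c d} → c ≗ d → subAt i m c ≗ subAt i m d
subAt-cong i m c≗d n with n ≟ i
... | yes _ = cong (_∸ m) (c≗d n)
... | no _  = c≗d n

addAt-subAt-comm : ∀ {i j} → i ≢ j → ∀ x y c → addAt i x (subAt j y c) ≗ subAt j y (addAt i x c)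
addAt-subAt-comm {i} {j} i≢j x y c n = by-cases (n ≟ i) (n ≟ j)
  where
  by-cases : Dec (n ≡ i) → Dec (n ≡ j) → addAt i x (subAt j y c) n ≡ subAt j y (addAt i x c) n
  by-cases (yes refl) _ = begin
    addAt n x (subAt j y c) n  ≡⟨ addAt-same n x _ ⟩
    subAt j y c n + x          ≡⟨ cong (_+ x) (subAt-other j y c i≢j) ⟩
    c n + x                    ≡⟨ addAt-same n x c ⟨
    addAt n x c n              ≡⟨ subAt-other j y _ i≢j ⟨
    subAt j y (addAt n x c) n  ∎
    where open ≡-Reasoning
  by-cases (no n≢i) (yes refl) = begin
    addAt i x (subAt n y c) n  ≡⟨ addAt-other i x _ n≢i ⟩
    subAt n y c n              ≡⟨ subAt-same n y c ⟩
    c n ∸ y                    ≡⟨ cong (_∸ y) (addAt-other i x c n≢i) ⟨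
    addAt i x c n ∸ y          ≡⟨ subAt-same n y _ ⟨
    subAt n y (addAt i x c) n  ∎
    where open ≡-Reasoning
  by-cases (no n≢i) (no n≢j) = begin
    addAt i x (subAt j y c) n  ≡⟨ addAt-other i x _ n≢i ⟩
    subAt j y c n              ≡⟨ subAt-other j y c n≢j ⟩
    c n                        ≡⟨ addAt-other i x c n≢i ⟨
    addAt i x c n              ≡⟨ subAt-other j y _ n≢j ⟨
    subAt j y (addAt i x c) n  ∎
    where open ≡-Reasoning

[m+x]∸[n+x]≡m∸n : ∀ m n x → (m + x) ∸ (n + x) ≡ m ∸ n
[m+x]∸[n+x]≡m∸n m n x = trans (cong₂ _∸_ (+-comm m x) (+-comm n x)) ([m+n]∸[m+o]≡n∸o x m n)

subAt-+-addAt : ∀ i x y c → subAt i (y + x) (addAt i x c) ≗ subAt i y c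
subAt-+-addAt i x y c n = by-cases (n ≟ i)
  where
  by-cases : Dec (n ≡ i) → subAt i (y + x) (addAt i x c) n ≡ subAt i y c n
  by-cases (yes refl) = begin
    subAt n (y + x) (addAt n x c) n  ≡⟨ subAt-same n (y + x) _ ⟩
    addAt n x c n ∸ (y + x)          ≡⟨ cong (_∸ (y + x)) (addAt-same n x c) ⟩
    (c n + x) ∸ (y + x)              ≡⟨ [m+x]∸[n+x]≡m∸n (c n) y x ⟩
    c n ∸ y                          ≡⟨ subAt-same n y c ⟨
    subAt n y c n                    ∎
    where open ≡-Reasoning
  by-cases (no n≢i) =
    trans (subAt-other i (y + x) _ n≢i) (trans (addAt-other i x c n≢i) (sym (subAt-other i y c n≢i)))

addAt-subAt-inverse : ∀ i x c → x ≤ c i → addAt i x (subAt i x c) ≗ c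
addAt-subAt-inverse i x c x≤cᵢ n = by-cases (n ≟ i)
  where
  by-cases : Dec (n ≡ i) → addAt i x (subAt i x c) n ≡ c n
  by-cases (yes refl) = trans (addAt-same n x _) (trans (cong (_+ x) (subAt-same n x c)) (m∸n+n≡m x≤cᵢ))
  by-cases (no n≢i)   = trans (addAt-other i x _ n≢i) (subAt-other i x c n≢i)

fire-cong : ∀ a b i {c d} → c ≗ d → fire a b i c ≗ fire a b i d
fire-cong a b zero          c≗d = c≗d
fire-cong a b (suc zero)    c≗d = addAt-cong 2 b (subAt-cong 1 (a + b) c≗d)
fire-cong a b (suc (suc p)) c≗d =
  addAt-cong (3 + p) b (addAt-cong (suc p) a (subAt-cong (2 + p) (a + b) c≗d))

module Cascade (a b : ℕ) (s : Config) where

  -- cascade m: s with b chips added at vertex 1, after vertices 1, …, m have fired once each.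
  cascade : ℕ → Config
  cascade zero    = addAt 1 b s
  cascade (suc m) = addAt (suc (suc m)) b (subAt (suc m) a s)

  AtLeastUpTo : ℕ → Set
  AtLeastUpTo m = ∀ i → 1 ≤ i → i ≤ m → a ≤ s i

  -- StopsAt m: m + 1 is the index j of the theorem, the first vertex of s holding fewer than a chips.
  StopsAt : ℕ → Set
  StopsAt m = AtLeastUpTo m × s (suc m) < a

  atLeastUpTo-zero : AtLeastUpTo 0
  atLeastUpTo-zero _ (s≤s _) ()

  atLeastUpTo-suc : ∀ {m} → AtLeastUpTo m → a ≤ s (suc m) → AtLeastUpTo (suc m)
  atLeastUpTo-suc full a≤next i 1≤i i≤1+m with m≤n⇒m<n∨m≡n i≤1+m
  ... | inj₁ i<1+m = full i 1≤i (≤-pred i<1+m)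
  ... | inj₂ refl  = a≤next

  atLeastUpTo-bounded : 0 < a → ∀ {k m} → (∀ i → k < i → s i ≡ 0) → AtLeastUpTo m → m ≤ k
  atLeastUpTo-bounded 0<a {k} {m} zeros full with m ≤? k
  ... | yes m≤k = m≤k
  ... | no m≰k  = ⊥-elim (<⇒≱ 0<a (subst (a ≤_) (zeros (suc k) ≤-refl) (full (suc k) (s≤s z≤n) (≰⇒> m≰k))))

  stopsAt-unique : ∀ {m m'} → StopsAt m → StopsAt m' → m ≡ m'
  stopsAt-unique {m} {m'} (full , below) (full' , below') with <-cmp m m'
  ... | tri< m<m' _ _ = ⊥-elim (<⇒≱ below (full' (suc m) (s≤s z≤n) m<m'))
  ... | tri≈ _ m≡m' _ = m≡m'
  ... | tri> _ _ m>m' = ⊥-elim (<⇒≱ below' (full (suc m') (s≤s z≤n) m>m'))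

  cascade-top : ∀ m → cascade m (suc m) ≡ s (suc m) + b
  cascade-top zero    = addAt-same 1 b s
  cascade-top (suc m) = trans (addAt-same (2 + m) b _) (cong (_+ b) (subAt-other (suc m) a s (1+n≢n)))

  cascade-fired : ∀ p → cascade (suc p) (suc p) ≡ s (suc p) ∸ a
  cascade-fired p = trans (addAt-other (2 + p) b _ (<⇒≢ (n<1+n (suc p)))) (subAt-same (suc p) a s)

  cascade-zero-other : ∀ {n} → n ≢ 1 → cascade 0 n ≡ s n
  cascade-zero-other = addAt-other 1 b s

  cascade-suc-other : ∀ {p n} → n ≢ suc p → n ≢ suc (suc p) → cascade (suc p) n ≡ s n
  cascade-suc-other {p} n≢1+p n≢2+p = trans (addAt-other (2 + p) b _ n≢2+p) (subAt-other (suc p) a s n≢1+p)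

  cascade-≤ : ∀ m {i} → i ≢ suc m → cascade m i ≤ s i
  cascade-≤ zero    i≢1 = ≤-reflexive (cascade-zero-other i≢1)
  cascade-≤ (suc p) {i} i≢2+p with i ≟ suc p
  ... | yes refl  = ≤-trans (≤-reflexive (cascade-fired p)) (m∸n≤m (s (suc p)) a)
  ... | no i≢1+p  = ≤-reflexive (cascade-suc-other i≢1+p i≢2+p)

  fire-cascade : ∀ m → AtLeastUpTo m → fire a b (suc m) (cascade m) ≗ cascade (suc m)
  fire-cascade zero    _    = addAt-cong 2 b (subAt-+-addAt 1 b a s)
  fire-cascade (suc p) full = addAt-cong (3 + p) b (begin
      addAt (suc p) a (subAt (2 + p) (a + b) (addAt (2 + p) b (subAt (suc p) a s)))
    ≈⟨ addAt-cong (suc p) a (subAt-+-addAt (2 + p) b a _) ⟩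
      addAt (suc p) a (subAt (2 + p) a (subAt (suc p) a s))
    ≈⟨ addAt-subAt-comm (<⇒≢ (n<1+n (suc p))) a a _ ⟩
      subAt (2 + p) a (addAt (suc p) a (subAt (suc p) a s))
    ≈⟨ subAt-cong (2 + p) a (addAt-subAt-inverse (suc p) a s (full (suc p) (s≤s z≤n) ≤-refl)) ⟩
      subAt (2 + p) a s
    ∎)
    where open SetoidReasoning (ℕ →-setoid ℕ)

  isJ⇒stopsAt : 0 < a → ∀ {ℓ j} → (∀ i → ℓ < i → s i ≡ 0) → IsJ a s ℓ j → ∃ λ m → j ≡ suc m × StopsAt m
  isJ⇒stopsAt _ {j = suc m} _ (inj₁ (_ , _ , below , full)) = m , refl , (λ i 1≤i i≤m → full i 1≤i (s≤s i≤m)) , below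
  isJ⇒stopsAt 0<a {ℓ} zeros (inj₂ (refl , full)) = ℓ , refl , full , subst (_< a) (sym (zeros (suc ℓ) ≤-refl)) 0<a

  cascade-zeros : ∀ {k m} → (∀ i → k < i → s i ≡ 0) → m ≤ k → ∀ i → suc k < i → cascade m i ≡ 0
  cascade-zeros zeros m≤k i 1+k<i =
    n≤0⇒n≡0 (≤-trans (cascade-≤ _ (>⇒≢ (≤-<-trans (s≤s m≤k) 1+k<i))) (≤-reflexive (zeros i (<-trans (n<1+n _) 1+k<i))))

  cascade-shape : ∀ {j c'} m → AtLeastUpTo m → j ≡ suc m → c' ≗ cascade m →
    (j ≡ 1 → c' 1 ≡ s 1 + b × (∀ i → 1 < i → c' i ≡ s i)) ×
    (1 < j → c' (j ∸ 1) + a ≡ s (j ∸ 1) × c' j ≡ s j + b ×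
       (∀ i → 1 ≤ i → i ≢ j ∸ 1 → i ≢ j → c' i ≡ s i))
  cascade-shape zero _ refl c'≗ =
    (λ _ → trans (c'≗ 1) (cascade-top 0) , λ i 1<i → trans (c'≗ i) (cascade-zero-other (>⇒≢ 1<i))) ,
    λ { (s≤s ()) }
  cascade-shape (suc p) full refl c'≗ =
    (λ ()) ,
    λ _ → trans (cong (_+ a) (trans (c'≗ (suc p)) (cascade-fired p))) (m∸n+n≡m (full (suc p) (s≤s z≤n) ≤-refl)) ,
          trans (c'≗ (2 + p)) (cascade-top (suc p)) ,
          λ i _ i≢1+p i≢2+p → trans (c'≗ i) (cascade-suc-other i≢1+p i≢2+p)

  module _ (stable : Stable a b s) where

    only-top-unstable : ∀ m {c i} → c ≗ cascade m → 1 ≤ i → a + b ≤ c i → i ≡ suc m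
    only-top-unstable m {c} {i} c≗ 1≤i unstable with i ≟ suc m
    ... | yes i≡1+m = i≡1+m
    ... | no i≢1+m  =
      ⊥-elim (<⇒≱ (≤-<-trans (≤-trans (≤-reflexive (c≗ i)) (cascade-≤ m i≢1+m)) (stable i 1≤i)) unstable)

    cascade-stable : ∀ m {c} → c ≗ cascade m → s (suc m) < a → Stable a b c
    cascade-stable m {c} c≗ below i 1≤i with i ≟ suc m
    ... | yes refl = subst (_< a + b) (sym (trans (c≗ i) (cascade-top m))) (+-monoˡ-< b below)
    ... | no i≢1+m = ≤-<-trans (≤-trans (≤-reflexive (c≗ i)) (cascade-≤ m i≢1+m)) (stable i 1≤i)

    cascade-settles : ∀ m {c c'} → Fires a b c c' → c ≗ cascade m → AtLeastUpTo m → Stable a b c' →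
      ∃ λ m' → StopsAt m' × c' ≗ cascade m'
    cascade-settles m done c≗ full stable' =
      m , (full , +-cancelʳ-< b _ _ (subst (_< a + b) (trans (c≗ (suc m)) (cascade-top m)) (stable' (suc m) (s≤s z≤n)))) , c≗
    cascade-settles m {c} (step i 1≤i unstable F) c≗ full stable' with only-top-unstable m c≗ 1≤i unstable
    ... | refl = cascade-settles (suc m) F (λ n → trans (fire-cong a b (suc m) c≗ n) (fire-cascade m full n))
      (atLeastUpTo-suc full (+-cancelʳ-≤ b _ _ (subst (a + b ≤_) (trans (c≗ (suc m)) (cascade-top m)) unstable)))
      stable'

    cascade-runs : 0 < a → ∀ n m {c} → (∀ i → m + n < i → s i ≡ 0) → c ≗ cascade m → AtLeastUpTo m →
      ∃ λ c' → Fires a b c c' × Stable a b c'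
    cascade-runs 0<a n m {c} zeros c≗ full with a ≤? s (suc m)
    ... | no a≰next = c , done , cascade-stable m c≗ (≰⇒> a≰next)
    cascade-runs 0<a zero m zeros c≗ full | yes a≤next =
      ⊥-elim (<⇒≱ 0<a (subst (a ≤_) (zeros (suc m) (s≤s (≤-reflexive (+-identityʳ m)))) a≤next))
    cascade-runs 0<a (suc n) m {c} zeros c≗ full | yes a≤next =
      let (c' , F , stable') = cascade-runs 0<a n (suc m)
                                 (λ i m+1+n<i → zeros i (subst (_< i) (sym (+-suc m n)) m+1+n<i))
                                 (λ k → trans (fire-cong a b (suc m) c≗ k) (fire-cascade m full k))
                                 (atLeastUpTo-suc full a≤next)
          top-unstable = subst (a + b ≤_) (sym (trans (c≗ (suc m)) (cascade-top m))) (+-monoˡ-≤ b a≤next)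
      in c' , step (suc m) (s≤s z≤n) top-unstable F , stable'

module Settlements (a b : ℕ) (0<a : 0 < a) where
  open Cascade a b

  settlement-invariant : ∀ {k c} → Settlement a b k c → Stable a b c × (∀ i → k < i → c i ≡ 0)
  settlement-invariant start = (λ _ _ → ≤-trans 0<a (m≤m+n a b)) , λ _ _ → refl
  settlement-invariant (next {c = c} hc F stable') =
    let (stable , zeros) = settlement-invariant hc
        (m , (full , _) , c'≗) = cascade-settles c stable 0 F (λ _ → refl) (atLeastUpTo-zero c) stable'
    in stable' , λ i 1+k<i → trans (c'≗ i) (cascade-zeros c zeros (atLeastUpTo-bounded c 0<a zeros full) i 1+k<i)

  settlement-unique : ∀ {k c d} → Settlement a b k c → Settlement a b k d → c ≗ d
  settlement-unique start start _ = refl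
  settlement-unique (next {c = c} hc F stable) (next hd G stable') n =
    let c≗d = settlement-unique hc hd
        (m , stop , c'≗) = cascade-settles c (proj₁ (settlement-invariant hc)) 0 F (λ _ → refl)
                             (atLeastUpTo-zero c) stable
        (m' , stop' , d'≗) = cascade-settles c (proj₁ (settlement-invariant hc)) 0 G
                               (addAt-cong 1 b (λ i → sym (c≗d i))) (atLeastUpTo-zero c) stable'
    in trans (c'≗ n) (trans (cong (λ m″ → cascade c m″ n) (stopsAt-unique c stop stop')) (sym (d'≗ n)))

  settlement-step : ∀ {k s s'} → Settlement a b k s → Settlement a b (suc k) s' →
    ∃ λ m → StopsAt s m × s' ≗ cascade s m
  settlement-step {s = s} hs (next hc F stable') =
    cascade-settles s (proj₁ (settlement-invariant hs)) 0 F (addAt-cong 1 b (settlement-unique hc hs))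
      (atLeastUpTo-zero s) stable'

  settlement-exists : ∀ {k s} → Settlement a b k s → ∃ λ s' → Settlement a b (suc k) s'
  settlement-exists {k} {s} hs =
    let (stable , zeros) = settlement-invariant hs
        (s' , F , stable') = cascade-runs s stable 0<a k 0 zeros (λ _ → refl) (atLeastUpTo-zero s)
    in s' , next hs F stable'

mainTheorem11 : ∀ (a b : ℕ) → 0 < a → a < b → Coprime a b →
    ∀ (k : ℕ) (s : Config) → Settlement a b k s →
    (∃ λ s' → Settlement a b (suc k) s') ×
    (∀ (s' : Config) → Settlement a b (suc k) s' →
     ∀ (ℓ : ℕ) → (∀ i → ℓ < i → s i ≡ 0) →
     ∀ (j : ℕ) → IsJ a s ℓ j →
     (j ≡ 1 → s' 1 ≡ s 1 + b × (∀ i → 1 < i → s' i ≡ s i)) ×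
     (1 < j → s' (j ∸ 1) + a ≡ s (j ∸ 1) × s' j ≡ s j + b ×
        (∀ i → 1 ≤ i → i ≢ j ∸ 1 → i ≢ j → s' i ≡ s i)))
mainTheorem11 a b 0<a _ _ k s hs = settlement-exists hs , λ s' hs' ℓ zeros j isJ →
  let (m , j≡1+m , stop) = isJ⇒stopsAt 0<a zeros isJ
      (m' , stop' , s'≗) = settlement-step hs hs'
  in cascade-shape m' (proj₁ stop') (trans j≡1+m (cong suc (stopsAt-unique stop stop'))) s'≗
  where
  open Settlements a b 0<a
  open Cascade a b s
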